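{- Let $I$ be a normal Riesz $\gamma$-ideal in the GPEA $P$, put $\sim:=\sim_I$, and let $U$ be the $\gamma$-unitization of $P$. Then $\sim^*$ is a Riesz congruence on $U$ iff $\sim$ satisfies the following condition on $P$: (GCR) $a\sim b\Rightarrow\exists\,i,j\in I: i\oplus a=j\oplus b$, or equivalently $\exists\,k,\ell\in I: a\oplus k=b\oplus\ell$.
   Context: $P$ is a GPEA (partial $\oplus$, constant $0$; partial associativity; conjugation; two-sided cancellation; neutral $0$; positivity), ordered by $a\le b$ iff $a\oplus c=b$ for some $c$; for $a\le b$, $a/b$ is the unique $c$ with $a\oplus c=b$ and $b\backslash a$ the unique $d$ with $d\oplus a=b$. $\gamma$ is a unitizing GPEA-automorphism ($\gamma a\oplus b$ defined iff $b\oplus a$ defined). The $\gamma$-unitization $U=P\cup P^\eta$ ($\eta$ a bijection onto a disjoint set, $1:=\eta0$): sums in $P$ as in $P$; $a+\eta b$ defined iff $a\le b$, equal to $\eta(b\backslash a)$; $\eta a+b$ defined iff $\gamma b\le a$, equal to $\eta(\gamma b/a)$; no sums within $P^\eta$; $U$ is a pseudo effect algebra with $\eta a=a^\sim$, $\gamma a=a^{ -- }$. Ideal: nonempty down-set closed under existing sums; normal: $a\oplus c=c\oplus b$ implies ($a\in I\Leftrightarrow b\in I$); $\gamma$-ideal: $a\in I\Leftrightarrow\gamma a\in I$. Riesz ideal: (R1) if $i\in I$, $i\le a\oplus b$ then $i\le j\oplus k$ for some $j,k\in I$, $j\le a$, $k\le b$; (R2) if $i\in I$, $i\le a$: (i)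 if $(a\backslash i)\oplus b$ exists there is $j\in I$, $j\le b$, with $a\oplus(j/b)$ existing; (ii) if $b\oplus(i/a)$ exists there is $k\in I$, $k\le b$, with $(b\backslash k)\oplus a$ existing. $a\sim_I b$ iff $a\backslash i=b\backslash j$ for some $i,j\in I$, $i\le a$, $j\le b$. $\sim^*$ on $U$: $a\sim^*b$ iff $a\sim b$, $\eta a\sim^*\eta b$ iff $a\sim b$, elements of $P$ and $P^\eta$ never related. A congruence is an equivalence compatible with existing sums ($a\oplus b$, $a_1\oplus b_1$ exist, $a\sim a_1$, $b\sim b_1\Rightarrow a\oplus b\sim a_1\oplus b_1$) such that if $a\oplus b$ exists then each $a_1\sim a$ has some $b_1\sim b$ with $a_1\oplus b_1$ existing and each $b_2\sim b$ has some $a_2\sim a$ with $a_2\oplus b_2$ existing. A Riesz congruence is a congruence satisfying (C4) [$a\sim b$ and ($a\oplus a_1\sim b\oplus b_1$ or $a_1\oplus a\sim b_1\oplus b$) imply $a_1\sim b_1$], (C5$'$) [$a\sim b\oplus c$ implies $a=a_1\oplus a_2$ with $a_1\sim b$, $a_2\sim c$], and (CR) [if $a\sim b$ there are $c,d$ with $c\le a\le d$, $c\le b\le d$, $a\backslash c\sim b\backslash c\sim0$, $d\backslash a\sim d\backslash b\sim0$]. -}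

module Defs where

open import Level using (Level; suc; _⊔_; Lift)
open import Data.Product using (Σ; ∃; ∃-syntax; _×_; _,_)
open import Data.Sum using (_⊎_; inj₁; inj₂)
open import Data.Empty using (⊥)
open import Relation.Binary.PropositionalEquality using (_≡_)
open import Function.Bundles using (_⇔_)
open import Function.Definitions using (Bijective)

-- Partial binary operations are represented relationally:
-- "S a b c" means "a ⊕ b is defined and equals c".

PSum : ∀ {ℓ} → Set ℓ → Set (suc ℓ)
PSum {ℓ} A = A → A → A → Set ℓ

module PartialOps {ℓ} {A : Set ℓ} (S : PSum A) where
  Defined : A → A → Set ℓ
  Defined a b = ∃[ c ] S a b c

  _≤_ : A → A → Set ℓ
  a ≤ b = ∃[ c ] S a c b

record GPEA ℓ : Set (suc ℓ) where
  field
    Carrier : Set ℓ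
    Sum     : PSum Carrier
    0#      : Carrier
    functional  : ∀ {a b c c'} → Sum a b c → Sum a b c' → c ≡ c'
    assocʳ : ∀ {a b c ab d} → Sum a b ab → Sum ab c d →
             ∃[ bc ] (Sum b c bc × Sum a bc d)
    assocˡ : ∀ {a b c bc d} → Sum b c bc → Sum a bc d →
             ∃[ ab ] (Sum a b ab × Sum ab c d)
    conjugation : ∀ {a b c} → Sum a b c →
                  (∃[ d ] Sum d a c) × (∃[ e ] Sum b e c)
    cancelˡ : ∀ {a b b' c} → Sum a b c → Sum a b' c → b ≡ b'
    cancelʳ : ∀ {a a' b c} → Sum a b c → Sum a' b c → a ≡ a'
    neutralʳ : ∀ a → Sum a 0# a
    neutralˡ : ∀ a → Sum 0# a a
    positive : ∀ {a b} → Sum a b 0# → (a ≡ 0#) × (b ≡ 0#)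

  open PartialOps Sum public

module Congruences {ℓ} {A : Set ℓ} (S : PSum A) (zero : A) where
  open PartialOps S

  record IsCongruence (_~_ : A → A → Set ℓ) : Set ℓ where
    field
      refl  : ∀ {a} → a ~ a
      sym   : ∀ {a b} → a ~ b → b ~ a
      trans : ∀ {a b c} → a ~ b → b ~ c → a ~ c
      compat : ∀ {a b c a₁ b₁ c₁} → S a b c → S a₁ b₁ c₁ →
               a ~ a₁ → b ~ b₁ → c ~ c₁
      liftˡ : ∀ {a b a₁} → Defined a b → a₁ ~ a →
              ∃[ b₁ ] (b₁ ~ b × Defined a₁ b₁)
      liftʳ : ∀ {a b b₂} → Defined a b → b₂ ~ b →
              ∃[ a₂ ] (a₂ ~ a × Defined a₂ b₂)

  C4 : (A → A → Set ℓ) → Set ℓ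
  C4 _~_ = ∀ {a b a₁ b₁ c d} → a ~ b →
             ((S a a₁ c × S b b₁ d × c ~ d) ⊎ (S a₁ a c × S b₁ b d × c ~ d)) →
             a₁ ~ b₁

  C5' : (A → A → Set ℓ) → Set ℓ
  C5' _~_ = ∀ {a b c bc} → S b c bc → a ~ bc →
              ∃[ a₁ ] ∃[ a₂ ] (S a₁ a₂ a × a₁ ~ b × a₂ ~ c)

  -- "x \ y ~ 0" for y ≤ x: the unique e with e ⊕ y = x satisfies e ~ 0
  LDiff~0 : (A → A → Set ℓ) → A → A → Set ℓ
  LDiff~0 _~_ x y = ∃[ e ] (S e y x × e ~ zero)

  CR : (A → A → Set ℓ) → Set ℓ
  CR _~_ = ∀ {a b} → a ~ b →
             ∃[ c ] ∃[ d ] (c ≤ a × a ≤ d × c ≤ b × b ≤ d ×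
               LDiff~0 _~_ a c × LDiff~0 _~_ b c ×
               LDiff~0 _~_ d a × LDiff~0 _~_ d b)

  record IsRieszCongruence (_~_ : A → A → Set ℓ) : Set ℓ where
    field
      isCongruence : IsCongruence _~_
      c4  : C4 _~_
      c5' : C5' _~_
      cr  : CR _~_

module OnGPEA {ℓ} (P : GPEA ℓ) where
  open GPEA P

  IsAutomorphism : (Carrier → Carrier) → Set ℓ
  IsAutomorphism γ = Bijective _≡_ _≡_ γ ×
    (∀ a b c → Sum a b c ⇔ Sum (γ a) (γ b) (γ c))

  IsUnitizing : (Carrier → Carrier) → Set ℓ
  IsUnitizing γ = ∀ a b → Defined (γ a) b ⇔ Defined b a

  IsUnitizingAutomorphism : (Carrier → Carrier) → Set ℓ
  IsUnitizingAutomorphism γ = IsAutomorphism γ × IsUnitizing γ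

  record IsIdeal (I : Carrier → Set ℓ) : Set ℓ where
    field
      nonempty : ∃[ x ] I x
      downward : ∀ {a b} → a ≤ b → I b → I a
      sumClosed : ∀ {a b c} → I a → I b → Sum a b c → I c

  IsNormal : (Carrier → Set ℓ) → Set ℓ
  IsNormal I = ∀ {a b c x} → Sum a c x → Sum c b x → (I a ⇔ I b)

  Isγ : (Carrier → Carrier) → (Carrier → Set ℓ) → Set ℓ
  Isγ γ I = ∀ a → I a ⇔ I (γ a)

  R1 : (Carrier → Set ℓ) → Set ℓ
  R1 I = ∀ {i a b ab} → I i → Sum a b ab → i ≤ ab →
           ∃[ j ] ∃[ k ] (I j × I k × j ≤ a × k ≤ b ×
             ∃[ jk ] (Sum j k jk × i ≤ jk))

  -- (R2)(i): a \ i = d (d ⊕ i = a); j / b = f (j ⊕ f = b)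
  R2i : (Carrier → Set ℓ) → Set ℓ
  R2i I = ∀ {i a b d} → I i → i ≤ a → Sum d i a → Defined d b →
            ∃[ j ] (I j × j ≤ b × ∃[ f ] (Sum j f b × Defined a f))

  -- (R2)(ii): i / a = f (i ⊕ f = a); b \ k = g (g ⊕ k = b)
  R2ii : (Carrier → Set ℓ) → Set ℓ
  R2ii I = ∀ {i a b f} → I i → i ≤ a → Sum i f a → Defined b f →
             ∃[ k ] (I k × k ≤ b × ∃[ g ] (Sum g k b × Defined g a))

  record IsRieszIdeal (I : Carrier → Set ℓ) : Set ℓ where
    field
      isIdeal : IsIdeal I
      r1   : R1 I
      r2i  : R2i I
      r2ii : R2ii I

  -- a ~_I b iff a \ i = b \ j for some i, j ∈ I, i ≤ a, j ≤ b
  ~I : (Carrier → Set ℓ) → Carrier → Carrier → Set ℓ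
  ~I I a b = ∃[ i ] ∃[ j ] (I i × I j × i ≤ a × j ≤ b ×
               ∃[ e ] (Sum e i a × Sum e j b))

  GCR : (Carrier → Set ℓ) → (Carrier → Carrier → Set ℓ) → Set ℓ
  GCR I _~_ = ∀ {a b} → a ~ b →
                ∃[ i ] ∃[ j ] (I i × I j × ∃[ c ] (Sum i a c × Sum j b c))

  GCR' : (Carrier → Set ℓ) → (Carrier → Carrier → Set ℓ) → Set ℓ
  GCR' I _~_ = ∀ {a b} → a ~ b →
                 ∃[ k ] ∃[ l ] (I k × I l × ∃[ c ] (Sum a k c × Sum b l c))

  -- γ-unitization U = P ∪ P^η, with inj₁ = P and inj₂ = η

  U : Set ℓ
  U = Carrier ⊎ Carrier

  USum : (Carrier → Carrier) → PSum U
  USum γ (inj₁ a) (inj₁ b) (inj₁ c) = Sum a b c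
  -- a + η b defined iff a ≤ b, equal to η (b \ a); c = b \ a iff c ⊕ a = b
  USum γ (inj₁ a) (inj₂ b) (inj₂ c) = Sum c a b
  -- η a + b defined iff γ b ≤ a, equal to η (γ b / a); c = γ b / a iff γ b ⊕ c = a
  USum γ (inj₂ a) (inj₁ b) (inj₂ c) = Sum (γ b) c a
  USum γ _ _ _ = Lift ℓ ⊥

  U0 : U
  U0 = inj₁ 0#

  Star : (Carrier → Carrier → Set ℓ) → U → U → Set ℓ
  Star _~_ (inj₁ a) (inj₁ b) = a ~ b
  Star _~_ (inj₂ a) (inj₂ b) = a ~ b
  Star _~_ _ _ = Lift ℓ ⊥

module Submission where

-- We first study ~ on P.  For a normal ideal, ~ is reflexive and symmetric,
-- absorbs ideal summands on either side, has I as the class of 0, and can be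
-- witnessed by left as well as right complements (which gives GCR ⇔ GCR').
-- For a Riesz ideal, (R1) produces a common left part of two decompositions,
-- whence transitivity, compatibility with ⊕ and (C5'); (R2) gives the two
-- lifting conditions.  Under (GCR) common summands cancel modulo ~, the core
-- of (C4).  An automorphism γ preserving I preserves and reflects ~.
-- On U every sum has one of the shapes a + b, a + ηb, ηa + b, and each axiom
-- of a Riesz congruence reduces shape by shape to a fact about P; (CR) is
-- built from (GCR).  Conversely (CR) applied inside P yields (GCR) at once.

open import Defs
open import Level using (lift)
open import Data.Product using (_×_; _,_; proj₁; proj₂; ∃-syntax)
open import Data.Sum using (inj₁; inj₂)
open import Function.Bundles using (_⇔_; mk⇔; Equivalence)
open import Relation.Binary.PropositionalEquality using (_≡_; refl; sym; subst)
open import Relation.Binary.Bundles using (Setoid)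
import Relation.Binary.Reasoning.Setoid as SetoidReasoning

module GPEAFacts {ℓ} (P : GPEA ℓ) where
  open GPEA P

  ≤-rightSummand : ∀ {a b c} → Sum a b c → b ≤ c
  ≤-rightSummand a⊕b = proj₂ (conjugation a⊕b)

  ≤-leftComplement : ∀ {a b} → a ≤ b → ∃[ d ] Sum d a b
  ≤-leftComplement (_ , a⊕c) = proj₁ (conjugation a⊕c)

  ≤-trans : ∀ {a b c} → a ≤ b → b ≤ c → a ≤ c
  ≤-trans (x , a⊕x) (y , b⊕y) with assocʳ a⊕x b⊕y
  ... | xy , _ , a⊕xy = xy , a⊕xy

  assocʳ-at : ∀ {a b c ab bc d} → Sum a b ab → Sum ab c d → Sum b c bc → Sum a bc d
  assocʳ-at a⊕b ab⊕c b⊕c with assocʳ a⊕b ab⊕c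
  ... | _ , b⊕c′ , a⊕bc = subst (λ bc → Sum _ bc _) (functional b⊕c′ b⊕c) a⊕bc

  assocˡ-at : ∀ {a b c ab bc d} → Sum b c bc → Sum a bc d → Sum a b ab → Sum ab c d
  assocˡ-at b⊕c a⊕bc a⊕b with assocˡ b⊕c a⊕bc
  ... | _ , a⊕b′ , ab⊕c = subst (λ ab → Sum ab _ _) (functional a⊕b′ a⊕b) ab⊕c

  ⊕-monoʳ-≤ : ∀ {a b b′ ab ab′} → b ≤ b′ → Sum a b ab → Sum a b′ ab′ → ab ≤ ab′
  ⊕-monoʳ-≤ (r , b⊕r) a⊕b a⊕b′ = r , assocˡ-at b⊕r a⊕b′ a⊕b

module IdealRelation {ℓ} (P : GPEA ℓ) (I : GPEA.Carrier P → Set ℓ) where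
  open GPEA P
  open OnGPEA P
  open GPEAFacts P

  _~_ : Carrier → Carrier → Set ℓ
  _~_ = ~I I

  ~-intro : ∀ {e i j a b} → I i → I j → Sum e i a → Sum e j b → a ~ b
  ~-intro i∈I j∈I e⊕i e⊕j =
    _ , _ , i∈I , j∈I , ≤-rightSummand e⊕i , ≤-rightSummand e⊕j , _ , e⊕i , e⊕j

  ~-sym : ∀ {a b} → a ~ b → b ~ a
  ~-sym (i , j , i∈I , j∈I , i≤a , j≤b , e , e⊕i , e⊕j) =
    j , i , j∈I , i∈I , j≤b , i≤a , e , e⊕j , e⊕i

module AutomorphismInvariance {ℓ} (P : GPEA ℓ) {γ : GPEA.Carrier P → GPEA.Carrier P}
  (aut : OnGPEA.IsAutomorphism P γ) {I : GPEA.Carrier P → Set ℓ}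
  (γ-invariant : OnGPEA.Isγ P γ I) where
  open GPEA P
  open IdealRelation P I

  γ-onto : ∀ y → ∃[ x ] γ x ≡ y
  γ-onto y with proj₂ (proj₁ aut) y
  ... | x , γx≡y = x , γx≡y refl

  γ-sum : ∀ {a b c} → Sum a b c → Sum (γ a) (γ b) (γ c)
  γ-sum = Equivalence.to (proj₂ aut _ _ _)

  γ-sum⁻¹ : ∀ {a b c} → Sum (γ a) (γ b) (γ c) → Sum a b c
  γ-sum⁻¹ = Equivalence.from (proj₂ aut _ _ _)

  ~-γ : ∀ {a b} → a ~ b → γ a ~ γ b
  ~-γ (i , j , i∈I , j∈I , _ , _ , e , e⊕i , e⊕j) =
    ~-intro (Equivalence.to (γ-invariant i) i∈I) (Equivalence.to (γ-invariant j) j∈I)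
            (γ-sum e⊕i) (γ-sum e⊕j)

  -- Every summand of γ a lies in the image of γ, so the witnesses pull back.
  ~-γ⁻¹ : ∀ {a b} → γ a ~ γ b → a ~ b
  ~-γ⁻¹ (i , j , i∈I , j∈I , _ , _ , e , e⊕i , e⊕j)
    with γ-onto e | γ-onto i | γ-onto j
  ... | _ , refl | i′ , refl | j′ , refl =
    ~-intro (Equivalence.from (γ-invariant i′) i∈I) (Equivalence.from (γ-invariant j′) j∈I)
            (γ-sum⁻¹ e⊕i) (γ-sum⁻¹ e⊕j)

  ~-γ-preimage : ∀ {x b} → x ~ γ b → ∃[ b₁ ] (γ b₁ ≡ x × b₁ ~ b)
  ~-γ-preimage {x} x~γb with γ-onto x
  ... | b₁ , refl = b₁ , refl , ~-γ⁻¹ x~γb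

module NormalIdealRelation {ℓ} (P : GPEA ℓ) {I : GPEA.Carrier P → Set ℓ}
  (ideal : OnGPEA.IsIdeal P I) (normal : OnGPEA.IsNormal P I) where
  open GPEA P
  open OnGPEA P
  open IsIdeal ideal
  open IdealRelation P I public

  0∈I : I 0#
  0∈I with nonempty
  ... | x , x∈I = downward (x , neutralˡ x) x∈I

  -- Normality moves an ideal summand to the other side of a sum.
  ideal-toLeft : ∀ {e i a} → Sum e i a → I i → ∃[ i′ ] (I i′ × Sum i′ e a)
  ideal-toLeft e⊕i i∈I with proj₁ (conjugation e⊕i)
  ... | i′ , i′⊕e = i′ , Equivalence.from (normal i′⊕e e⊕i) i∈I , i′⊕e

  ideal-toRight : ∀ {i e a} → Sum i e a → I i → ∃[ i′ ] (I i′ × Sum e i′ a)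
  ideal-toRight i⊕e i∈I with proj₂ (conjugation i⊕e)
  ... | i′ , e⊕i′ = i′ , Equivalence.to (normal i⊕e e⊕i′) i∈I , e⊕i′

  ~-refl : ∀ {a} → a ~ a
  ~-refl {a} = ~-intro 0∈I 0∈I (neutralʳ a) (neutralʳ a)

  ~-absorbʳ : ∀ {x i y} → Sum x i y → I i → y ~ x
  ~-absorbʳ {x} x⊕i i∈I = ~-intro i∈I 0∈I x⊕i (neutralʳ x)

  ~-absorbˡ : ∀ {i x y} → Sum i x y → I i → y ~ x
  ~-absorbˡ i⊕x i∈I with ideal-toRight i⊕x i∈I
  ... | _ , i′∈I , x⊕i′ = ~-absorbʳ x⊕i′ i′∈I

  I⇒~0 : ∀ {x} → I x → x ~ 0#
  I⇒~0 {x} x∈I = ~-absorbˡ (neutralʳ x) x∈I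

  ~0⇒I : ∀ {x} → x ~ 0# → I x
  ~0⇒I (i , j , i∈I , _ , _ , _ , e , e⊕i , e⊕j) with positive e⊕j
  ... | refl , refl = subst I (functional (neutralˡ i) e⊕i) i∈I

  ~-leftForm : ∀ {a b} → a ~ b →
               ∃[ h ] ∃[ i ] ∃[ j ] (I i × I j × Sum i h a × Sum j h b)
  ~-leftForm (i , j , i∈I , j∈I , _ , _ , e , e⊕i , e⊕j)
    with ideal-toLeft e⊕i i∈I | ideal-toLeft e⊕j j∈I
  ... | i′ , i′∈I , i′⊕e | j′ , j′∈I , j′⊕e = e , i′ , j′ , i′∈I , j′∈I , i′⊕e , j′⊕e

  GCR⇔GCR' : ∀ {_≈_ : Carrier → Carrier → Set ℓ} → GCR I _≈_ ⇔ GCR' I _≈_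
  GCR⇔GCR' = mk⇔ toRight toLeft
    where
    toRight : ∀ {_≈_} → GCR I _≈_ → GCR' I _≈_
    toRight gcr a≈b with gcr a≈b
    ... | i , j , i∈I , j∈I , c , i⊕a , j⊕b
      with ideal-toRight i⊕a i∈I | ideal-toRight j⊕b j∈I
    ... | k , k∈I , a⊕k | l , l∈I , b⊕l = k , l , k∈I , l∈I , c , a⊕k , b⊕l

    toLeft : ∀ {_≈_} → GCR' I _≈_ → GCR I _≈_
    toLeft gcr′ a≈b with gcr′ a≈b
    ... | k , l , k∈I , l∈I , c , a⊕k , b⊕l
      with ideal-toLeft a⊕k k∈I | ideal-toLeft b⊕l l∈I
    ... | i , i∈I , i⊕a | j , j∈I , j⊕b = i , j , i∈I , j∈I , c , i⊕a , j⊕b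

module RieszIdealRelation {ℓ} (P : GPEA ℓ) {I : GPEA.Carrier P → Set ℓ}
  (riesz : OnGPEA.IsRieszIdeal P I) (normal : OnGPEA.IsNormal P I) where
  open GPEA P
  open OnGPEA P
  open GPEAFacts P
  open IsRieszIdeal riesz
  open IsIdeal isIdeal
  open NormalIdealRelation P isIdeal normal public

  -- (R1) as it is used below: an ideal right summand j of f ⊕ j = x ⊕ y can be
  -- traded against an ideal part p of x, i.e. x = g ⊕ p, f = g ⊕ d and
  -- d ⊕ j = p ⊕ y.
  riesz-shift : ∀ {f j x y s} → I j → Sum f j s → Sum x y s →
                ∃[ g ] ∃[ p ] ∃[ d ] ∃[ m ]
                  (I p × Sum g p x × Sum p y m × Sum d j m × Sum g d f)
  riesz-shift j∈I f⊕j x⊕y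
    with r1 j∈I x⊕y (≤-rightSummand f⊕j)
  ... | p , q , p∈I , _ , p≤x , q≤y , pq , p⊕q , j≤pq
    with ≤-leftComplement p≤x
  ... | g , g⊕p
    with assocʳ g⊕p x⊕y
  ... | m , p⊕y , g⊕m
    with ≤-leftComplement (≤-trans j≤pq (⊕-monoʳ-≤ q≤y p⊕q p⊕y))
  ... | d , d⊕j
    with assocˡ d⊕j g⊕m
  ... | gd , g⊕d , gd⊕j =
    g , p , d , m , p∈I , g⊕p , p⊕y , d⊕j , subst (Sum g d) (cancelʳ gd⊕j f⊕j) g⊕d

  commonLeftPart : ∀ {e i f j b} → I i → I j → Sum e i b → Sum f j b →
                   ∃[ g ] ∃[ x ] ∃[ y ] (I x × I y × Sum g x e × Sum g y f)
  commonLeftPart i∈I j∈I e⊕i f⊕j with riesz-shift j∈I f⊕j e⊕i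
  ... | g , p , d , m , p∈I , g⊕p , p⊕i , d⊕j , g⊕d =
    g , p , d , p∈I , downward (_ , d⊕j) (sumClosed p∈I i∈I p⊕i) , g⊕p , g⊕d

  ~-trans : ∀ {a b c} → a ~ b → b ~ c → a ~ c
  ~-trans (i , j , i∈I , j∈I , _ , _ , e , e⊕i , e⊕j) (j′ , k , j′∈I , k∈I , _ , _ , f , f⊕j′ , f⊕k)
    with commonLeftPart j∈I j′∈I e⊕j f⊕j′
  ... | g , x , y , x∈I , y∈I , g⊕x , g⊕y
    with assocʳ g⊕x e⊕i | assocʳ g⊕y f⊕k
  ... | xi , x⊕i , g⊕xi | yk , y⊕k , g⊕yk =
    ~-intro (sumClosed x∈I i∈I x⊕i) (sumClosed y∈I k∈I y⊕k) g⊕xi g⊕yk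

  ~-setoid : Setoid ℓ ℓ
  ~-setoid = record
    { Carrier = Carrier
    ; _≈_ = _~_
    ; isEquivalence = record { refl = ~-refl ; sym = ~-sym ; trans = ~-trans }
    }

  open SetoidReasoning ~-setoid

  ~-compat : ∀ {a b c a₁ b₁ c₁} → Sum a b c → Sum a₁ b₁ c₁ → a ~ a₁ → b ~ b₁ → c ~ c₁
  ~-compat {c = c} {c₁ = c₁} a⊕b a₁⊕b₁ a~a₁ (k , l , k∈I , l∈I , _ , _ , g , g⊕k , g⊕l)
    with assocˡ g⊕k a⊕b | assocˡ g⊕l a₁⊕b₁ | ~-leftForm a~a₁
  ... | ag , a⊕g , ag⊕k | a₁g , a₁⊕g , a₁g⊕l | h , i , j , i∈I , j∈I , i⊕h , j⊕h
    with assocʳ i⊕h a⊕g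
  ... | hg , h⊕g , i⊕hg = begin
    c   ≈⟨ ~-absorbʳ ag⊕k k∈I ⟩
    ag  ≈⟨ ~-absorbˡ i⊕hg i∈I ⟩
    hg  ≈⟨ ~-absorbˡ (assocʳ-at j⊕h a₁⊕g h⊕g) j∈I ⟨
    a₁g ≈⟨ ~-absorbʳ a₁g⊕l l∈I ⟨
    c₁  ∎

  ~-split : ∀ {a b c bc} → Sum b c bc → a ~ bc →
            ∃[ a₁ ] ∃[ a₂ ] (Sum a₁ a₂ a × a₁ ~ b × a₂ ~ c)
  ~-split {c = c} b⊕c (i , j , i∈I , j∈I , _ , _ , e , e⊕i , e⊕j)
    with riesz-shift j∈I e⊕j b⊕c
  ... | g , p , d , m , p∈I , g⊕p , p⊕c , d⊕j , g⊕d
    with assocʳ g⊕d e⊕i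
  ... | y , d⊕i , g⊕y = g , y , g⊕y , ~-sym (~-absorbʳ g⊕p p∈I) , (begin
    y ≈⟨ ~-absorbʳ d⊕i i∈I ⟩
    d ≈⟨ ~-absorbʳ d⊕j j∈I ⟨
    m ≈⟨ ~-absorbˡ p⊕c p∈I ⟩
    c ∎)

  ~-liftˡ : ∀ {a b a₁} → Defined a b → a₁ ~ a → ∃[ b₁ ] (b₁ ~ b × Defined a₁ b₁)
  ~-liftˡ (_ , a⊕b) (i₁ , i₂ , i₁∈I , i₂∈I , i₁≤a₁ , _ , e , e⊕i₁ , e⊕i₂)
    with assocʳ e⊕i₂ a⊕b
  ... | b′ , i₂⊕b , e⊕b′
    with r2i i₁∈I i₁≤a₁ e⊕i₁ (_ , e⊕b′)
  ... | j , j∈I , _ , f , j⊕f , a₁⊕f =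
    f , ~-trans (~-sym (~-absorbˡ j⊕f j∈I)) (~-absorbˡ i₂⊕b i₂∈I) , a₁⊕f

  ~-liftʳ : ∀ {a b b₂} → Defined a b → b₂ ~ b → ∃[ a₂ ] (a₂ ~ a × Defined a₂ b₂)
  ~-liftʳ (_ , a⊕b) b₂~b with ~-leftForm b₂~b
  ... | h , i , j , i∈I , j∈I , i⊕h , j⊕h
    with assocˡ j⊕h a⊕b
  ... | a′ , a⊕j , a′⊕h
    with r2ii i∈I (h , i⊕h) i⊕h (_ , a′⊕h)
  ... | k , k∈I , _ , g , g⊕k , g⊕b₂ =
    g , ~-trans (~-sym (~-absorbʳ g⊕k k∈I)) (~-absorbʳ a⊕j j∈I) , g⊕b₂

  module Cancellation (gcr : GCR I _~_) where

    gcr' : GCR' I _~_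
    gcr' = Equivalence.to GCR⇔GCR' gcr

    ~-cancelʳ-common : ∀ {u v h uh vh} → Sum u h uh → Sum v h vh → uh ~ vh → u ~ v
    ~-cancelʳ-common u⊕h v⊕h uh~vh with gcr' uh~vh
    ... | k , l , k∈I , l∈I , _ , uh⊕k , vh⊕l
      with assocʳ u⊕h uh⊕k | assocʳ v⊕h vh⊕l
    ... | _ , h⊕k , u⊕hk | _ , h⊕l , v⊕hl
      with ideal-toLeft h⊕k k∈I | ideal-toLeft h⊕l l∈I
    ... | k′ , k′∈I , k′⊕h | l′ , l′∈I , l′⊕h
      with assocˡ k′⊕h u⊕hk | assocˡ l′⊕h v⊕hl
    ... | _ , u⊕k′ , uk′⊕h | _ , v⊕l′ , vl′⊕h with cancelʳ uk′⊕h vl′⊕h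
    ... | refl = ~-trans (~-sym (~-absorbʳ u⊕k′ k′∈I)) (~-absorbʳ v⊕l′ l′∈I)

    ~-cancelˡ-common : ∀ {h u v hu hv} → Sum h u hu → Sum h v hv → hu ~ hv → u ~ v
    ~-cancelˡ-common h⊕u h⊕v hu~hv with gcr hu~hv
    ... | i , j , i∈I , j∈I , _ , i⊕hu , j⊕hv
      with assocˡ h⊕u i⊕hu | assocˡ h⊕v j⊕hv
    ... | _ , i⊕h , ih⊕u | _ , j⊕h , jh⊕v
      with ideal-toRight i⊕h i∈I | ideal-toRight j⊕h j∈I
    ... | i′ , i′∈I , h⊕i′ | j′ , j′∈I , h⊕j′
      with assocʳ h⊕i′ ih⊕u | assocʳ h⊕j′ jh⊕v
    ... | _ , i′⊕u , h⊕i′u | _ , j′⊕v , h⊕j′v with cancelˡ h⊕i′u h⊕j′v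
    ... | refl = ~-trans (~-sym (~-absorbˡ i′⊕u i′∈I)) (~-absorbˡ j′⊕v j′∈I)

    ~-cancelʳ : ∀ {y x z y₁ x₁ z₁} → Sum y x z → Sum y₁ x₁ z₁ → x ~ x₁ → z ~ z₁ → y ~ y₁
    ~-cancelʳ {z = z} {z₁ = z₁} y⊕x y₁⊕x₁ (i , j , i∈I , j∈I , _ , _ , h , h⊕i , h⊕j) z~z₁
      with assocˡ h⊕i y⊕x | assocˡ h⊕j y₁⊕x₁
    ... | yh , y⊕h , yh⊕i | y₁h , y₁⊕h , y₁h⊕j = ~-cancelʳ-common y⊕h y₁⊕h (begin
      yh  ≈⟨ ~-absorbʳ yh⊕i i∈I ⟨
      z   ≈⟨ z~z₁ ⟩
      z₁  ≈⟨ ~-absorbʳ y₁h⊕j j∈I ⟩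
      y₁h ∎)

    ~-cancelˡ : ∀ {x y z x₁ y₁ z₁} → Sum x y z → Sum x₁ y₁ z₁ → x ~ x₁ → z ~ z₁ → y ~ y₁
    ~-cancelˡ {z = z} {z₁ = z₁} x⊕y x₁⊕y₁ x~x₁ z~z₁ with ~-leftForm x~x₁
    ... | h , i , j , i∈I , j∈I , i⊕h , j⊕h
      with assocʳ i⊕h x⊕y | assocʳ j⊕h x₁⊕y₁
    ... | hy , h⊕y , i⊕hy | hy₁ , h⊕y₁ , j⊕hy₁ = ~-cancelˡ-common h⊕y h⊕y₁ (begin
      hy  ≈⟨ ~-absorbˡ i⊕hy i∈I ⟨
      z   ≈⟨ z~z₁ ⟩
      z₁  ≈⟨ ~-absorbˡ j⊕hy₁ j∈I ⟩
      hy₁ ∎)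

module Unitization {ℓ} (P : GPEA ℓ) (γ : GPEA.Carrier P → GPEA.Carrier P)
  (I : GPEA.Carrier P → Set ℓ) (aut : OnGPEA.IsAutomorphism P γ)
  (riesz : OnGPEA.IsRieszIdeal P I) (normal : OnGPEA.IsNormal P I)
  (γ-invariant : OnGPEA.Isγ P γ I) where
  open GPEA P
  open OnGPEA P
  open GPEAFacts P
  open RieszIdealRelation P riesz normal
  open AutomorphismInvariance P aut γ-invariant
  open Congruences (USum γ) U0

  _~*_ : U → U → Set ℓ
  _~*_ = Star _~_

  _≤ᵁ_ : U → U → Set ℓ
  _≤ᵁ_ = PartialOps._≤_ (USum γ)

  ~-split-γ : ∀ {a b c a₁} → Sum (γ b) c a → a₁ ~ a →
              ∃[ b₁ ] ∃[ c₁ ] (Sum (γ b₁) c₁ a₁ × b₁ ~ b × c₁ ~ c)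
  ~-split-γ γb⊕c a₁~a =
    let x , c₁ , x⊕c₁ , x~γb , c₁~c = ~-split γb⊕c a₁~a
        b₁ , γb₁≡x , b₁~b = ~-γ-preimage x~γb
    in b₁ , c₁ , subst (λ z → Sum z c₁ _) (sym γb₁≡x) x⊕c₁ , b₁~b , c₁~c

  ~-liftʳ-γ : ∀ {b c a₂} → Defined (γ b) c → a₂ ~ c →
              ∃[ b₂ ] (b₂ ~ b × Defined (γ b₂) a₂)
  ~-liftʳ-γ γb⊕c a₂~c =
    let x , x~γb , x⊕a₂ = ~-liftʳ γb⊕c a₂~c
        b₂ , γb₂≡x , b₂~b = ~-γ-preimage x~γb
    in b₂ , b₂~b , subst (λ z → Defined z _) (sym γb₂≡x) x⊕a₂

  data Shape : U → U → U → Set ℓ where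
    P+P : ∀ {a b c} → Sum a b c → Shape (inj₁ a) (inj₁ b) (inj₁ c)
    P+η : ∀ {a b c} → Sum c a b → Shape (inj₁ a) (inj₂ b) (inj₂ c)
    η+P : ∀ {a b c} → Sum (γ b) c a → Shape (inj₂ a) (inj₁ b) (inj₂ c)

  shape : ∀ {a b c} → USum γ a b c → Shape a b c
  shape {inj₁ _} {inj₁ _} {inj₁ _} s = P+P s
  shape {inj₁ _} {inj₂ _} {inj₂ _} s = P+η s
  shape {inj₂ _} {inj₁ _} {inj₂ _} s = η+P s
  shape {inj₁ _} {inj₁ _} {inj₂ _} (lift ())
  shape {inj₁ _} {inj₂ _} {inj₁ _} (lift ())
  shape {inj₂ _} {inj₁ _} {inj₁ _} (lift ())
  shape {inj₂ _} {inj₂ _} {inj₁ _} (lift ())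
  shape {inj₂ _} {inj₂ _} {inj₂ _} (lift ())

  ~*-refl : ∀ {a} → a ~* a
  ~*-refl {inj₁ _} = ~-refl
  ~*-refl {inj₂ _} = ~-refl

  ~*-sym : ∀ {a b} → a ~* b → b ~* a
  ~*-sym {inj₁ _} {inj₁ _} a~b = ~-sym a~b
  ~*-sym {inj₂ _} {inj₂ _} a~b = ~-sym a~b
  ~*-sym {inj₁ _} {inj₂ _} (lift ())
  ~*-sym {inj₂ _} {inj₁ _} (lift ())

  ~*-trans : ∀ {a b c} → a ~* b → b ~* c → a ~* c
  ~*-trans {inj₁ _} {inj₁ _} {inj₁ _} a~b b~c = ~-trans a~b b~c
  ~*-trans {inj₂ _} {inj₂ _} {inj₂ _} a~b b~c = ~-trans a~b b~c
  ~*-trans {inj₁ _} {inj₂ _} (lift ()) _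
  ~*-trans {inj₂ _} {inj₁ _} (lift ()) _
  ~*-trans {inj₁ _} {inj₁ _} {inj₂ _} _ (lift ())
  ~*-trans {inj₂ _} {inj₂ _} {inj₁ _} _ (lift ())

  ~*-liftˡ : ∀ {a b c a₁} → Shape a b c → a₁ ~* a →
             ∃[ b₁ ] (b₁ ~* b × ∃[ c₁ ] USum γ a₁ b₁ c₁)
  ~*-liftˡ {a₁ = inj₁ _} (P+P a⊕b) a₁~a =
    let b₁ , b₁~b , c₁ , a₁⊕b₁ = ~-liftˡ (_ , a⊕b) a₁~a
    in inj₁ b₁ , b₁~b , inj₁ c₁ , a₁⊕b₁
  ~*-liftˡ {a₁ = inj₁ _} (P+η c⊕a) a₁~a =
    let c₁ , c₁~c , b₁ , c₁⊕a₁ = ~-liftʳ (_ , c⊕a) a₁~a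
    in inj₂ b₁ , ~-compat c₁⊕a₁ c⊕a c₁~c a₁~a , inj₂ c₁ , c₁⊕a₁
  ~*-liftˡ {a₁ = inj₂ _} (η+P γb⊕c) a₁~a =
    let b₁ , c₁ , γb₁⊕c₁ , b₁~b , _ = ~-split-γ γb⊕c a₁~a
    in inj₁ b₁ , b₁~b , inj₂ c₁ , γb₁⊕c₁
  ~*-liftˡ {a₁ = inj₂ _} (P+P _) (lift ())
  ~*-liftˡ {a₁ = inj₂ _} (P+η _) (lift ())
  ~*-liftˡ {a₁ = inj₁ _} (η+P _) (lift ())

  ~*-liftʳ : ∀ {a b c b₂} → Shape a b c → b₂ ~* b →
             ∃[ a₂ ] (a₂ ~* a × ∃[ c₂ ] USum γ a₂ b₂ c₂)
  ~*-liftʳ {b₂ = inj₁ _} (P+P a⊕b) b₂~b =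
    let a₂ , a₂~a , c₂ , a₂⊕b₂ = ~-liftʳ (_ , a⊕b) b₂~b
    in inj₁ a₂ , a₂~a , inj₁ c₂ , a₂⊕b₂
  ~*-liftʳ {b₂ = inj₂ _} (P+η c⊕a) b₂~b =
    let c₂ , a₂ , c₂⊕a₂ , _ , a₂~a = ~-split c⊕a b₂~b
    in inj₁ a₂ , a₂~a , inj₂ c₂ , c₂⊕a₂
  ~*-liftʳ {b₂ = inj₁ _} (η+P γb⊕c) b₂~b =
    let γb₂~γb = ~-γ b₂~b
        c₂ , c₂~c , a₂ , γb₂⊕c₂ = ~-liftˡ (_ , γb⊕c) γb₂~γb
    in inj₂ a₂ , ~-compat γb₂⊕c₂ γb⊕c γb₂~γb c₂~c , inj₂ c₂ , γb₂⊕c₂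
  ~*-liftʳ {b₂ = inj₂ _} (P+P _) (lift ())
  ~*-liftʳ {b₂ = inj₁ _} (P+η _) (lift ())
  ~*-liftʳ {b₂ = inj₂ _} (η+P _) (lift ())

  ~*-split : ∀ {a b c bc} → Shape b c bc → a ~* bc →
             ∃[ a₁ ] ∃[ a₂ ] (USum γ a₁ a₂ a × a₁ ~* b × a₂ ~* c)
  ~*-split {a = inj₁ _} (P+P b⊕c) a~bc =
    let a₁ , a₂ , a₁⊕a₂ , a₁~b , a₂~c = ~-split b⊕c a~bc
    in inj₁ a₁ , inj₁ a₂ , a₁⊕a₂ , a₁~b , a₂~c
  ~*-split {a = inj₂ _} (P+η bc⊕b) a~bc =
    let a₁ , a₁~b , a₂ , a⊕a₁ = ~-liftˡ (_ , bc⊕b) a~bc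
    in inj₁ a₁ , inj₂ a₂ , a⊕a₁ , a₁~b , ~-compat a⊕a₁ bc⊕b a~bc a₁~b
  ~*-split {a = inj₂ _} (η+P γc⊕bc) a~bc =
    let a₂ , a₂~c , a₁ , γa₂⊕a = ~-liftʳ-γ (_ , γc⊕bc) a~bc
    in inj₂ a₁ , inj₁ a₂ , γa₂⊕a , ~-compat γa₂⊕a γc⊕bc (~-γ a₂~c) a~bc , a₂~c
  ~*-split {a = inj₂ _} (P+P _) (lift ())
  ~*-split {a = inj₁ _} (P+η _) (lift ())
  ~*-split {a = inj₁ _} (η+P _) (lift ())

  P-diff : ∀ {k x y} → I k → Sum k x y → LDiff~0 _~*_ (inj₁ y) (inj₁ x)
  P-diff k∈I k⊕x = inj₁ _ , k⊕x , I⇒~0 k∈I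

  η-diff : ∀ {k x y} → I k → Sum y k x → LDiff~0 _~*_ (inj₂ y) (inj₂ x)
  η-diff k∈I y⊕k = inj₁ _ , y⊕k , I⇒~0 k∈I

  P-≤ : ∀ {x y} → x ≤ y → inj₁ x ≤ᵁ inj₁ y
  P-≤ (z , x⊕z) = inj₁ z , x⊕z

  η-antitone : ∀ {k x y} → Sum y k x → inj₂ x ≤ᵁ inj₂ y
  η-antitone y⊕k =
    let w , w⊕y = proj₁ (conjugation y⊕k)
        z , γz≡w = γ-onto w
    in inj₁ z , subst (λ v → Sum v _ _) (sym γz≡w) w⊕y

  nullDifferences⇒GCR : ∀ {d a b} → LDiff~0 _~*_ d (inj₁ a) → LDiff~0 _~*_ d (inj₁ b) →
                        ∃[ i ] ∃[ j ] (I i × I j × ∃[ c ] (Sum i a c × Sum j b c))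
  nullDifferences⇒GCR {inj₁ d} (inj₁ i , i⊕a , i~0) (inj₁ j , j⊕b , j~0) =
    i , j , ~0⇒I i~0 , ~0⇒I j~0 , d , i⊕a , j⊕b
  nullDifferences⇒GCR {inj₁ _} (inj₂ _ , _ , lift ()) _
  nullDifferences⇒GCR {inj₁ _} (inj₁ _ , _ , _) (inj₂ _ , _ , lift ())
  nullDifferences⇒GCR {inj₂ _} (inj₁ _ , lift () , _) _
  nullDifferences⇒GCR {inj₂ _} (inj₂ _ , _ , lift ()) _

  RieszCongruence⇒GCR : IsRieszCongruence _~*_ → GCR I _~_
  RieszCongruence⇒GCR rc {a} {b} a~b =
    let _ , _ , _ , _ , _ , _ , _ , _ , d∖a , d∖b = IsRieszCongruence.cr rc {inj₁ a} {inj₁ b} a~b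
    in nullDifferences⇒GCR d∖a d∖b

  module UnderGCR (gcr : GCR I _~_) where
    open Cancellation gcr

    -- In two sums of the same shape, any two ~*-related positions force the
    -- third: compatibility and (C4).
    ~*-compat : ∀ {a b c a₁ b₁ c₁} → Shape a b c → Shape a₁ b₁ c₁ →
                a ~* a₁ → b ~* b₁ → c ~* c₁
    ~*-compat (P+P a⊕b) (P+P a₁⊕b₁) a~a₁ b~b₁ = ~-compat a⊕b a₁⊕b₁ a~a₁ b~b₁
    ~*-compat (P+η c⊕a) (P+η c₁⊕a₁) a~a₁ b~b₁ = ~-cancelʳ c⊕a c₁⊕a₁ a~a₁ b~b₁
    ~*-compat (η+P γb⊕c) (η+P γb₁⊕c₁) a~a₁ b~b₁ = ~-cancelˡ γb⊕c γb₁⊕c₁ (~-γ b~b₁) a~a₁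
    ~*-compat (P+P _) (P+η _) _ (lift ())
    ~*-compat (P+P _) (η+P _) (lift ()) _
    ~*-compat (P+η _) (P+P _) _ (lift ())
    ~*-compat (P+η _) (η+P _) (lift ()) _
    ~*-compat (η+P _) (P+P _) (lift ()) _
    ~*-compat (η+P _) (P+η _) (lift ()) _

    ~*-cancelˡ : ∀ {a b c a₁ b₁ c₁} → Shape a b c → Shape a₁ b₁ c₁ →
                 a ~* a₁ → c ~* c₁ → b ~* b₁
    ~*-cancelˡ (P+P a⊕b) (P+P a₁⊕b₁) a~a₁ c~c₁ = ~-cancelˡ a⊕b a₁⊕b₁ a~a₁ c~c₁
    ~*-cancelˡ (P+η c⊕a) (P+η c₁⊕a₁) a~a₁ c~c₁ = ~-compat c⊕a c₁⊕a₁ c~c₁ a~a₁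
    ~*-cancelˡ (η+P γb⊕c) (η+P γb₁⊕c₁) a~a₁ c~c₁ = ~-γ⁻¹ (~-cancelʳ γb⊕c γb₁⊕c₁ c~c₁ a~a₁)
    ~*-cancelˡ (P+P _) (P+η _) _ (lift ())
    ~*-cancelˡ (P+P _) (η+P _) (lift ()) _
    ~*-cancelˡ (P+η _) (P+P _) _ (lift ())
    ~*-cancelˡ (P+η _) (η+P _) (lift ()) _
    ~*-cancelˡ (η+P _) (P+P _) (lift ()) _
    ~*-cancelˡ (η+P _) (P+η _) (lift ()) _

    ~*-cancelʳ : ∀ {a b c a₁ b₁ c₁} → Shape a b c → Shape a₁ b₁ c₁ →
                 b ~* b₁ → c ~* c₁ → a ~* a₁
    ~*-cancelʳ (P+P a⊕b) (P+P a₁⊕b₁) b~b₁ c~c₁ = ~-cancelʳ a⊕b a₁⊕b₁ b~b₁ c~c₁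
    ~*-cancelʳ (P+η c⊕a) (P+η c₁⊕a₁) b~b₁ c~c₁ = ~-cancelˡ c⊕a c₁⊕a₁ c~c₁ b~b₁
    ~*-cancelʳ (η+P γb⊕c) (η+P γb₁⊕c₁) b~b₁ c~c₁ = ~-compat γb⊕c γb₁⊕c₁ (~-γ b~b₁) c~c₁
    ~*-cancelʳ (P+P _) (P+η _) (lift ()) _
    ~*-cancelʳ (P+P _) (η+P _) _ (lift ())
    ~*-cancelʳ (P+η _) (P+P _) (lift ()) _
    ~*-cancelʳ (P+η _) (η+P _) (lift ()) _
    ~*-cancelʳ (η+P _) (P+P _) _ (lift ())
    ~*-cancelʳ (η+P _) (P+η _) (lift ()) _

    -- (CR): for a ~ b in P take c the common left part and d the common
    -- upper bound from (GCR); in P^η the roles are swapped since η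
    -- reverses the order, and (GCR') supplies the lower bound.
    ~*-CR : CR _~*_
    ~*-CR {inj₁ a} {inj₁ b} a~b@(i , j , i∈I , j∈I , _ , _ , e , e⊕i , e⊕j) =
      let i′ , i′∈I , i′⊕e = ideal-toLeft e⊕i i∈I
          j′ , j′∈I , j′⊕e = ideal-toLeft e⊕j j∈I
          k , l , k∈I , l∈I , d , k⊕a , l⊕b = gcr a~b
      in inj₁ e , inj₁ d ,
         P-≤ (i , e⊕i) , P-≤ (≤-rightSummand k⊕a) , P-≤ (j , e⊕j) , P-≤ (≤-rightSummand l⊕b) ,
         P-diff i′∈I i′⊕e , P-diff j′∈I j′⊕e , P-diff k∈I k⊕a , P-diff l∈I l⊕b
    ~*-CR {inj₂ a} {inj₂ b} a~b@(i , j , i∈I , j∈I , _ , _ , d , d⊕i , d⊕j) =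
      let k , l , k∈I , l∈I , c , a⊕k , b⊕l = gcr' a~b
      in inj₂ c , inj₂ d ,
         η-antitone a⊕k , η-antitone d⊕i , η-antitone b⊕l , η-antitone d⊕j ,
         η-diff k∈I a⊕k , η-diff l∈I b⊕l , η-diff i∈I d⊕i , η-diff j∈I d⊕j
    ~*-CR {inj₁ _} {inj₂ _} (lift ())
    ~*-CR {inj₂ _} {inj₁ _} (lift ())

    -- USum γ and ~* compute by cases on their arguments, so those arguments
    -- cannot be inferred and are passed explicitly.
    ~*-isRieszCongruence : IsRieszCongruence _~*_
    ~*-isRieszCongruence = record
      { isCongruence = record
        { refl   = λ {a} → ~*-refl {a}
        ; sym    = λ {a} {b} → ~*-sym {a} {b}
        ; trans  = λ {a} {b} {c} → ~*-trans {a} {b} {c}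
        ; compat = λ {a} {b} {c} {a₁} {b₁} {c₁} a+b a₁+b₁ →
            ~*-compat (shape {a} {b} {c} a+b) (shape {a₁} {b₁} {c₁} a₁+b₁)
        ; liftˡ  = λ {a} {b} {a₁} (c , a+b) → ~*-liftˡ {a₁ = a₁} (shape {a} {b} {c} a+b)
        ; liftʳ  = λ {a} {b} {b₂} (c , a+b) → ~*-liftʳ {b₂ = b₂} (shape {a} {b} {c} a+b)
        }
      ; c4  = λ { {a} {b} {a₁} {b₁} {c} {d} a~b (inj₁ (a+a₁ , b+b₁ , c~d)) →
                    ~*-cancelˡ (shape {a} {a₁} {c} a+a₁) (shape {b} {b₁} {d} b+b₁) a~b c~d
                ; {a} {b} {a₁} {b₁} {c} {d} a~b (inj₂ (a₁+a , b₁+b , c~d)) →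
                    ~*-cancelʳ (shape {a₁} {a} {c} a₁+a) (shape {b₁} {b} {d} b₁+b) a~b c~d }
      ; c5' = λ {a} {b} {c} {bc} b+c → ~*-split {a = a} (shape {b} {c} {bc} b+c)
      ; cr  = ~*-CR
      }

  RieszCongruence⇔GCR : IsRieszCongruence _~*_ ⇔ GCR I _~_
  RieszCongruence⇔GCR =
    mk⇔ RieszCongruence⇒GCR (λ gcr → UnderGCR.~*-isRieszCongruence gcr)

theorem4p19 : ∀ {ℓ} (P : GPEA ℓ) (γ : GPEA.Carrier P → GPEA.Carrier P)
                (I : GPEA.Carrier P → Set ℓ) →
              OnGPEA.IsUnitizingAutomorphism P γ →
              OnGPEA.IsRieszIdeal P I → OnGPEA.IsNormal P I → OnGPEA.Isγ P γ I →
              (Congruences.IsRieszCongruence (OnGPEA.USum P γ) (OnGPEA.U0 P)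
                 (OnGPEA.Star P (OnGPEA.~I P I))
               ⇔ OnGPEA.GCR P I (OnGPEA.~I P I))
              × (OnGPEA.GCR P I (OnGPEA.~I P I) ⇔ OnGPEA.GCR' P I (OnGPEA.~I P I))
theorem4p19 P γ I (aut , _) riesz normal γ-invariant =
  Unitization.RieszCongruence⇔GCR P γ I aut riesz normal γ-invariant ,
  RieszIdealRelation.GCR⇔GCR' P riesz normal
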